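{- Let $j\ge 2$ be an integer. Then $(1,(2^{j}-1)^{2k}-1,(2^{j}-1)^{2k})$ is an $abc$ triple for each positive integer $k$.
   Context: For a positive integer $n$, $\operatorname{rad}(n)$ denotes the product of the distinct prime factors of $n$. An $abc$ triple is a triple $(a,b,c)$ of relatively prime positive integers with $a+b=c$ and $\operatorname{rad}(abc)<c$. -}

module Defs where

open import Data.Nat using (ℕ; suc; _+_; _*_; _<_)
open import Data.Nat.Primality using (Prime; prime?)
open import Data.Nat.Divisibility using (_∣_; _∣?_)
open import Data.Nat.Coprimality using (Coprime)
open import Data.List using (List; filter; upTo)
open import Data.Nat.ListAction using (product)
open import Data.Product using (_×_)
open import Relation.Nullary.Decidable using (_×-dec_)
open import Relation.Binary.PropositionalEquality using (_≡_)

rad : ℕ → ℕ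
rad n = product (filter (λ p → prime? p ×-dec p ∣? n) (upTo (suc n)))

IsAbcTriple : ℕ → ℕ → ℕ → Set
IsAbcTriple a b c =
  (0 < a) × (0 < b) × (0 < c) ×
  Coprime a b × Coprime a c × Coprime b c ×
  (a + b ≡ c) × (rad (a * b * c) < c)

{-# OPTIONS --safe #-}
-- Let m = 2 ^ j - 1 and c = m ^ (2k). Then c - 1 is divisible by
-- m ^ 2 - 1 = 2 ^ (j + 1) (2 ^ (j - 1) - 1), say c - 1 = 2 ^ (j + 1) q, so every prime
-- dividing (c - 1) c divides 2 m q. Hence rad((c - 1) c) ≤ 2 m q < 2 ^ (j + 1) q = c - 1,
-- the strict inequality because m < 2 ^ j.
module Submission where

open import Defs
open import Data.Nat using (ℕ; zero; suc; _≤_; _<_; _∸_; _^_; _*_; _+_; z≤n; s≤s; z<s; NonZero; >-nonZero⁻¹; ≢-nonZero⁻¹)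
open import Data.Nat.Properties
open import Data.Nat.Primality using (Prime; prime?; ¬prime[1]; euclidsLemma; prime⇒irreducible)
open import Data.Nat.Divisibility
open import Data.Nat.Coprimality using (Coprime; 1-coprimeTo; coprime-+) renaming (sym to coprime-sym)
open import Data.Nat.ListAction using (product)
open import Data.List using (_∷_; upTo)
open import Data.List.Relation.Unary.All as All using (All; []; _∷_)
open import Data.List.Relation.Unary.All.Properties using (all-filter)
open import Data.List.Relation.Unary.AllPairs using ([]; _∷_)
open import Data.List.Relation.Unary.Unique.Propositional using (Unique)
open import Data.List.Relation.Unary.Unique.Propositional.Properties using (filter⁺; upTo⁺)
open import Data.Product using (_×_; _,_; ∃)
open import Data.Sum using (inj₁; inj₂)
open import Data.Empty using (⊥-elim)
open import Relation.Nullary using (Dec)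
open import Relation.Nullary.Decidable using (_×-dec_)
open import Relation.Binary.PropositionalEquality
open import Data.Nat.Tactic.RingSolver using (solve-∀)

private
  variable
    m n p q N : ℕ

prime∣prime⇒≡ : Prime p → Prime q → q ∣ p → q ≡ p
prime∣prime⇒≡ pp pq q∣p with prime⇒irreducible pp q∣p
... | inj₁ refl = ⊥-elim (¬prime[1] pq)
... | inj₂ q≡p  = q≡p

prime∣m*prime⇒∣m : Prime p → Prime q → p ≢ q → q ∣ m * p → q ∣ m
prime∣m*prime⇒∣m {m = m} pp pq p≢q q∣m*p with euclidsLemma m _ pq q∣m*p
... | inj₁ q∣m = q∣m
... | inj₂ q∣p = ⊥-elim (p≢q (sym (prime∣prime⇒≡ pp pq q∣p)))

prime∣m^n⇒∣m : ∀ m n → Prime p → p ∣ m ^ n → p ∣ m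
prime∣m^n⇒∣m m zero    pp p∣1 = ⊥-elim (¬prime[1] (subst Prime (∣1⇒≡1 p∣1) pp))
prime∣m^n⇒∣m m (suc n) pp p∣m^[1+n] with euclidsLemma m (m ^ n) pp p∣m^[1+n]
... | inj₁ p∣m   = p∣m
... | inj₂ p∣m^n = prime∣m^n⇒∣m m n pp p∣m^n

product-distinct-primes∣ : ∀ {ps} → Unique ps → All (λ p → Prime p × p ∣ N) ps → product ps ∣ N
product-distinct-primes∣ [] [] = 1∣ _
product-distinct-primes∣ {ps = p ∷ ps} (p∉ps ∷ unique) ((pp , divides r refl) ∷ divisors) =
  subst (_∣ r * p) (*-comm (product ps) p)
    (*-monoˡ-∣ p (product-distinct-primes∣ unique (All.zipWith divides-r (p∉ps , divisors))))
  where
  divides-r : ∀ {q} → p ≢ q × (Prime q × q ∣ r * p) → Prime q × q ∣ r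
  divides-r (p≢q , pq , q∣r*p) = pq , prime∣m*prime⇒∣m pp pq p≢q q∣r*p

prime-divisors∣⇒rad∣ : (∀ {p} → Prime p → p ∣ n → p ∣ N) → rad n ∣ N
prime-divisors∣⇒rad∣ {n} h =
  product-distinct-primes∣ (filter⁺ P? (upTo⁺ (suc n)))
    (All.map (λ (pp , p∣n) → pp , h pp p∣n) (all-filter P? (upTo (suc n))))
  where
  P? : ∀ p → Dec (Prime p × p ∣ n)
  P? = λ p → prime? p ×-dec p ∣? n

rad[2^e*q*m^n]∣2*m*q : ∀ e q m n → rad (2 ^ e * q * m ^ n) ∣ 2 * m * q
rad[2^e*q*m^n]∣2*m*q e q m n = prime-divisors∣⇒rad∣ divides-2*m*q
  where
  divides-2*m*q : Prime p → p ∣ 2 ^ e * q * m ^ n → p ∣ 2 * m * q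
  divides-2*m*q pp p∣ with euclidsLemma (2 ^ e * q) (m ^ n) pp p∣
  ... | inj₂ p∣m^n = ∣m⇒∣m*n q (∣n⇒∣m*n 2 (prime∣m^n⇒∣m m n pp p∣m^n))
  ... | inj₁ p∣2^e*q with euclidsLemma (2 ^ e) q pp p∣2^e*q
  ...   | inj₁ p∣2^e = ∣m⇒∣m*n q (∣m⇒∣m*n m (prime∣m^n⇒∣m 2 e pp p∣2^e))
  ...   | inj₂ p∣q   = ∣n⇒∣m*n (2 * m) p∣q

consecutive-abc : ∀ {b c} → c ≡ suc b → 0 < b → rad (1 * b * c) < c → IsAbcTriple 1 (c ∸ 1) c
consecutive-abc {b} refl b>0 rad<c =
  z<s , b>0 , z<s , 1-coprimeTo b , 1-coprimeTo (suc b) ,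
  coprime-sym (subst (λ a → Coprime a b) (+-comm b 1) (coprime-+ (1-coprimeTo b))) ,
  refl , rad<c

2^e*[1+q]≢0 : ∀ e q → NonZero (2 ^ e * suc q)
2^e*[1+q]≢0 e q = m*n≢0 (2 ^ e) (suc q) {{m^n≢0 2 e}}

power≡1+2^e*q⇒abc : ∀ e q m n → 2 * m ≤ 2 ^ e → m ^ n ≡ suc (2 ^ e * suc q) →
  IsAbcTriple 1 (m ^ n ∸ 1) (m ^ n)
power≡1+2^e*q⇒abc e q zero    (suc n) _ ()
power≡1+2^e*q⇒abc e q zero    zero    _ 1≡1+b =
  ⊥-elim (≢-nonZero⁻¹ _ {{2^e*[1+q]≢0 e q}} (sym (suc-injective 1≡1+b)))
power≡1+2^e*q⇒abc e q (suc m) n 2m≤2^e c≡1+b =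
  consecutive-abc c≡1+b (>-nonZero⁻¹ b {{2^e*[1+q]≢0 e q}}) rad<c
  where
  b c : ℕ
  b = 2 ^ e * suc q
  c = suc m ^ n
  rad<c : rad (1 * b * c) < c
  rad<c = begin-strict
    rad (1 * b * c)          ≡⟨ cong (λ x → rad (x * c)) (*-identityˡ b) ⟩
    rad (b * c)              ≤⟨ ∣⇒≤ (rad[2^e*q*m^n]∣2*m*q e (suc q) (suc m) n) ⟩
    2 * suc m * suc q        ≤⟨ *-monoˡ-≤ (suc q) 2m≤2^e ⟩
    b                        <⟨ n<1+n b ⟩
    suc b                    ≡⟨ sym c≡1+b ⟩
    c                        ∎
    where open ≤-Reasoning

suc^suc≡1+multiple : ∀ y k → ∃ λ G → suc y ^ suc k ≡ suc (y * suc G)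
suc^suc≡1+multiple y zero    = 0 , solve-∀
suc^suc≡1+multiple y (suc k) with suc^suc≡1+multiple y k
... | G , eq = suc G + y * suc G , trans (cong (suc y *_) eq) (step y G)
  where
  step : ∀ y G → suc y * suc (y * suc G) ≡ suc (y * suc (suc G + y * suc G))
  step = solve-∀

-- Powers of 2 are written as nested doublings so that t = 2 ^ i gives
-- 2 ^ (2 + i) and 2 ^ (3 + i) definitionally.
[4t-1]^2≡1+8t*[2t-1] : ∀ t → .{{NonZero t}} →
  ∃ λ r → (2 * (2 * t) ∸ 1) ^ 2 ≡ suc (2 * (2 * (2 * t)) * suc r)
[4t-1]^2≡1+8t*[2t-1] (suc v) = 2 * v , (begin
  (2 * (2 * suc v) ∸ 1) ^ 2    ≡⟨ cong (λ x → (x ∸ 1) ^ 2) (4t≡4+4v v) ⟩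
  (3 + 4 * v) ^ 2              ≡⟨ square v ⟩
  suc (2 * (2 * (2 * suc v)) * suc (2 * v)) ∎)
  where
  open ≡-Reasoning
  4t≡4+4v : ∀ v → 2 * (2 * suc v) ≡ 4 + 4 * v
  4t≡4+4v = solve-∀
  square : ∀ v → (3 + 4 * v) * ((3 + 4 * v) * 1) ≡ suc (2 * (2 * (2 * suc v)) * suc (2 * v))
  square = solve-∀

[4t-1]^[2k]≡1+8t*q : ∀ t → .{{NonZero t}} → ∀ k →
  ∃ λ q → (2 * (2 * t) ∸ 1) ^ (2 * suc k) ≡ suc (2 * (2 * (2 * t)) * suc q)
[4t-1]^[2k]≡1+8t*q t k
  with r , square ← [4t-1]^2≡1+8t*[2t-1] t
  with G , power ← suc^suc≡1+multiple (2 * (2 * (2 * t)) * suc r) k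
  = G + r * suc G , (begin
  4t-1 ^ (2 * suc k)           ≡⟨ sym (^-*-assoc 4t-1 2 (suc k)) ⟩
  (4t-1 ^ 2) ^ suc k           ≡⟨ cong (_^ suc k) square ⟩
  suc (8t * suc r) ^ suc k     ≡⟨ power ⟩
  suc (8t * suc r * suc G)     ≡⟨ cong suc (*-assoc 8t (suc r) (suc G)) ⟩
  suc (8t * (suc r * suc G))   ∎)
  where
  open ≡-Reasoning
  4t-1 8t : ℕ
  4t-1 = 2 * (2 * t) ∸ 1
  8t = 2 * (2 * (2 * t))

corollary3p9 : (j : ℕ) → 2 ≤ j → (k : ℕ) → 0 < k →
    IsAbcTriple 1 ((2 ^ j ∸ 1) ^ (2 * k) ∸ 1) ((2 ^ j ∸ 1) ^ (2 * k))
corollary3p9 (suc (suc i)) (s≤s (s≤s z≤n)) (suc k) _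
  with q , power ← [4t-1]^[2k]≡1+8t*q (2 ^ i) {{m^n≢0 2 i}} k =
  power≡1+2^e*q⇒abc (3 + i) q (2 ^ (2 + i) ∸ 1) (2 * suc k)
    (*-monoʳ-≤ 2 (m∸n≤m (2 ^ (2 + i)) 1)) power
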